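{- Let $j$ and $k$ be positive integers, and for integers $M, m$ let $\left[ M \atop m \right] = \binom{M}{m} - \binom{M}{m-1}$. Then, \begin{enumerate} \item ${\displaystyle \left(x + \frac{1}{x}\right)^{j-1}\left(x - \frac{1}{x}\right) = \sum_{m=1}^j \left[ j - 1 \atop m \right] x^{j - 2m}. }$ \item ${\displaystyle 2^k = \sum_{n=0}^k \left[{k-1 \atop n} \right] (k-2n). }$ \item If $j$ is odd, then ${\displaystyle \frac{2^j}{j} = \sum_{m=0}^j \left[j-1 \atop m \right] \frac{1}{j-2m} }.$ \item If $j$ is odd and $k$ is even, then \[ {\displaystyle \frac{2^{j+k}}{j(j+k)} = \sum_{m=1}^j \sum_{n=1}^k \left[j - 1 \atop m \right] \left[k-1 \atop n \right] \frac{1}{j-2m} \times \frac{1}{j-2m + k -2n}.} \] \end{enumerate}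
   Context: Here $\binom{M}{m}$ denotes the usual binomial coefficient (zero when $m<0$ or $m>M$). -}

module Defs where

open import Data.Nat as ℕ using (ℕ; zero; suc)
open import Data.Nat.Combinatorics using (_C_)
open import Data.Integer as ℤ using (ℤ; +_; -[1+_])
open import Data.Rational as ℚ using (ℚ; 0ℚ; 1ℚ; _*_; _+_; 1/_; ≢-nonZero)
open import Data.Product using (∃-syntax)
open import Relation.Binary.PropositionalEquality using (_≡_)
open import Relation.Nullary using (yes; no)

-- [ M ; m ] = (M choose m) - (M choose (m-1)), for M, m ≥ 0,
-- where (M choose -1) = 0.  (Data.Nat.Combinatorics._C_ is 0 for m > M.)
bracket : ℕ → ℕ → ℤ
bracket M zero    = + (M C 0)
bracket M (suc m) = ℤ.+ (M C suc m) ℤ.- ℤ.+ (M C m)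

sumℤ : ℕ → ℕ → (ℕ → ℤ) → ℤ
sumℤ a b f = go a (suc b ℕ.∸ a)
  where
  go : ℕ → ℕ → ℤ
  go i zero    = + 0
  go i (suc r) = f i ℤ.+ go (suc i) r

sumℚ : ℕ → ℕ → (ℕ → ℚ) → ℚ
sumℚ a b f = go a (suc b ℕ.∸ a)
  where
  go : ℕ → ℕ → ℚ
  go i zero    = 0ℚ
  go i (suc r) = f i + go (suc i) r

-- Reciprocal, totalised by inv 0 = 0 (only ever applied to nonzero values
-- in the statement).
inv : ℚ → ℚ
inv q with q ℚ.≟ 0ℚ
... | yes _ = 0ℚ
... | no q≢0 = 1/_ q {{≢-nonZero q≢0}}

powℕ : ℚ → ℕ → ℚ
powℕ x zero    = 1ℚ
powℕ x (suc n) = x * powℕ x n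

powℤ : ℚ → ℤ → ℚ
powℤ x (+ n)      = powℕ x n
powℤ x -[1+ n ]   = inv (powℕ x (suc n))

ofℤ : ℤ → ℚ
ofℤ z = z ℚ./ 1

ofℕ : ℕ → ℚ
ofℕ n = ofℤ (+ n)

Odd : ℕ → Set
Odd j = ∃[ t ] j ≡ suc (2 ℕ.* t)

Even : ℕ → Set
Even k = ∃[ t ] k ≡ 2 ℕ.* t

{-# OPTIONS --safe #-}

-- Write X for the shift of coefficient sequences (multiplication of the generating function
-- by X). Pascal's rule gives C(M+1,·) = (1 + X) C(M,·) and [M+1;·] = (1 + X) [M;·], while
-- [M;·] = (1 − X) C(M,·). Part 1 is then an induction on j, multiplying by x + 1/x, and part 2
-- telescopes to 2 Σ C(k−1,n) = 2^k. The absorption identity j [j−1;m] = C(j,m) (j − 2m) turns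
-- each summand of part 3 into C(j,m)/j (j is odd, so j − 2m ≠ 0), whence 2^j/j. In part 4 the
-- same rewrite of the outer factor leaves (1/j) Σ_m C(j,m) Σ_n [k−1;n] / (j + k − 2(m + n));
-- collecting by p = m + n produces the coefficients of (1 + X)^j [k−1;·] = [j+k−1;·], and
-- part 3 for the odd number j + k finishes.

module Submission where

open import Defs
open import Data.Nat as ℕ using (ℕ; _≤_; _∸_)
open import Data.Integer as ℤ using (ℤ; +_)
open import Data.Rational as ℚ using (ℚ; 0ℚ)
open import Data.Product using (_×_)
open import Relation.Binary.PropositionalEquality using (_≡_; _≢_)

open import Data.Nat using (zero; suc; _<_; s≤s)
import Data.Nat.Properties as ℕP
open import Data.Nat.Combinatorics using (_C_; nCk+nC[k+1]≡[n+1]C[k+1]; k>n⇒nCk≡0; nC1≡n)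
open import Data.Integer using (-[1+_])
import Data.Integer.Properties as ℤP
open import Data.Rational using (1ℚ; _+_; _*_; _-_; -_)
import Data.Rational.Properties as ℚP
import Data.Rational.Unnormalised as ℚᵘ
import Data.Rational.Unnormalised.Properties as ℚᵘP
open import Data.Product using (_,_)
open import Data.Empty using (⊥-elim)
open import Data.List using (_∷_; [])
open import Function using (_∘_)
open import Level using (0ℓ)
open import Relation.Nullary using (yes; no)
open import Relation.Nullary.Decidable.Core using (dec⇒maybe)
open import Relation.Binary.PropositionalEquality
  using (refl; sym; trans; cong; cong₂; module ≡-Reasoning)
open import Algebra.Bundles using (CommutativeMonoid)
open import Algebra.Properties.CommutativeSemigroup
  (CommutativeMonoid.commutativeSemigroup ℚP.*-1-commutativeMonoid)
  using (interchange; x∙yz≈y∙xz)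
open import Algebra.Properties.CommutativeSemigroup
  (CommutativeMonoid.commutativeSemigroup ℚP.+-0-commutativeMonoid)
  using () renaming (interchange to interchange⁺)
import Tactic.RingSolver.Core.AlmostCommutativeRing as ACR
open import Tactic.RingSolver using (solve-∀)
import Data.Integer.Tactic.RingSolver as ℤ-Solver
import Data.Nat.Tactic.RingSolver as ℕ-Solver

ℚ-ring : ACR.AlmostCommutativeRing 0ℓ 0ℓ
ℚ-ring = ACR.fromCommutativeRing ℚP.+-*-commutativeRing (λ x → dec⇒maybe (0ℚ ℚ.≟ x))

toℚᵘ-ofℤ : ∀ i → ℚ.toℚᵘ (ofℤ i) ℚᵘ.≃ ℚᵘ.mkℚᵘ i 0
toℚᵘ-ofℤ i = ℚP.toℚᵘ-fromℚᵘ (ℚᵘ.mkℚᵘ i 0)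

ofℤ-+ : ∀ i j → ofℤ (i ℤ.+ j) ≡ ofℤ i + ofℤ j
ofℤ-+ i j = ℚP.toℚᵘ-injective (begin
  ℚ.toℚᵘ (ofℤ (i ℤ.+ j))               ≈⟨ toℚᵘ-ofℤ (i ℤ.+ j) ⟩
  ℚᵘ.mkℚᵘ (i ℤ.+ j) 0                  ≈⟨ ℚᵘ.*≡* (cong (ℤ._* + 1) (sym (cong₂ ℤ._+_ (ℤP.*-identityʳ i)
                                                                                 (ℤP.*-identityʳ j)))) ⟩
  ℚᵘ.mkℚᵘ i 0 ℚᵘ.+ ℚᵘ.mkℚᵘ j 0         ≈⟨ ℚᵘP.+-cong (toℚᵘ-ofℤ i) (toℚᵘ-ofℤ j) ⟨
  ℚ.toℚᵘ (ofℤ i) ℚᵘ.+ ℚ.toℚᵘ (ofℤ j)   ≈⟨ ℚP.toℚᵘ-homo-+ (ofℤ i) (ofℤ j) ⟨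
  ℚ.toℚᵘ (ofℤ i + ofℤ j)               ∎)
  where open ℚᵘP.≃-Reasoning

ofℤ-* : ∀ i j → ofℤ (i ℤ.* j) ≡ ofℤ i * ofℤ j
ofℤ-* i j = ℚP.toℚᵘ-injective (begin
  ℚ.toℚᵘ (ofℤ (i ℤ.* j))               ≈⟨ toℚᵘ-ofℤ (i ℤ.* j) ⟩
  ℚᵘ.mkℚᵘ (i ℤ.* j) 0                  ≈⟨ ℚᵘ.*≡* refl ⟩
  ℚᵘ.mkℚᵘ i 0 ℚᵘ.* ℚᵘ.mkℚᵘ j 0         ≈⟨ ℚᵘP.*-cong (toℚᵘ-ofℤ i) (toℚᵘ-ofℤ j) ⟨
  ℚ.toℚᵘ (ofℤ i) ℚᵘ.* ℚ.toℚᵘ (ofℤ j)   ≈⟨ ℚP.toℚᵘ-homo-* (ofℤ i) (ofℤ j) ⟨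
  ℚ.toℚᵘ (ofℤ i * ofℤ j)               ∎)
  where open ℚᵘP.≃-Reasoning

ofℤ-neg : ∀ i → ofℤ (ℤ.- i) ≡ - ofℤ i
ofℤ-neg i = begin
  ofℤ (ℤ.- i)               ≡⟨ cong ofℤ (ℤP.-1*i≡-i i) ⟨
  ofℤ (ℤ.-1ℤ ℤ.* i)         ≡⟨ ofℤ-* ℤ.-1ℤ i ⟩
  - 1ℚ * ofℤ i              ≡⟨ ℚP.neg-distribˡ-* 1ℚ (ofℤ i) ⟨
  - (1ℚ * ofℤ i)            ≡⟨ cong -_ (ℚP.*-identityˡ (ofℤ i)) ⟩
  - ofℤ i                   ∎
  where open ≡-Reasoning

ofℤ-- : ∀ i j → ofℤ (i ℤ.- j) ≡ ofℤ i - ofℤ j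
ofℤ-- i j = trans (ofℤ-+ i (ℤ.- j)) (cong (_+_ (ofℤ i)) (ofℤ-neg j))

ofℤ-injective : ∀ {i j} → ofℤ i ≡ ofℤ j → i ≡ j
ofℤ-injective {i} {j} eq
  with ℚᵘP.≃-trans (ℚᵘP.≃-sym (toℚᵘ-ofℤ i)) (ℚᵘP.≃-trans (ℚP.toℚᵘ-cong eq) (toℚᵘ-ofℤ j))
... | ℚᵘ.*≡* i*1≡j*1 = trans (sym (ℤP.*-identityʳ i)) (trans i*1≡j*1 (ℤP.*-identityʳ j))

ofℕ-+ : ∀ m n → ofℕ (m ℕ.+ n) ≡ ofℕ m + ofℕ n
ofℕ-+ m n = ofℤ-+ (+ m) (+ n)

ofℕ-* : ∀ m n → ofℕ (m ℕ.* n) ≡ ofℕ m * ofℕ n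
ofℕ-* m n = trans (cong ofℤ (ℤP.pos-* m n)) (ofℤ-* (+ m) (+ n))

ofℕ-suc≢0 : ∀ n → ofℕ (suc n) ≢ 0ℚ
ofℕ-suc≢0 n eq with ofℤ-injective {+ suc n} {+ 0} eq
... | ()

inv-inverseʳ : ∀ {p} → p ≢ 0ℚ → p * inv p ≡ 1ℚ
inv-inverseʳ {p} p≢0 with p ℚ.≟ 0ℚ
... | yes p≡0 = ⊥-elim (p≢0 p≡0)
... | no ¬p≡0 = ℚP.*-inverseʳ p {{ℚ.≢-nonZero ¬p≡0}}

inv-unique : ∀ p {q} → p * q ≡ 1ℚ → inv p ≡ q
inv-unique p {q} pq≡1 with p ℚ.≟ 0ℚ
... | yes refl = ⊥-elim (0≢1 (trans (sym (ℚP.*-zeroˡ q)) pq≡1))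
  where
  0≢1 : 0ℚ ≢ 1ℚ
  0≢1 ()
... | no p≢0 = begin
  ℚ.1/ p               ≡⟨ ℚP.*-identityʳ (ℚ.1/ p) ⟨
  ℚ.1/ p * 1ℚ          ≡⟨ cong (ℚ.1/ p *_) pq≡1 ⟨
  ℚ.1/ p * (p * q)     ≡⟨ ℚP.*-assoc (ℚ.1/ p) p q ⟨
  ℚ.1/ p * p * q       ≡⟨ cong (_* q) (ℚP.*-inverseˡ p) ⟩
  1ℚ * q               ≡⟨ ℚP.*-identityˡ q ⟩
  q                    ∎
  where
  open ≡-Reasoning
  instance
    p-nonZero : ℚ.NonZero p
    p-nonZero = ℚ.≢-nonZero p≢0

-- Deciding 0ℚ ≟ p rather than p ≟ 0ℚ keeps `with` from abstracting the test inside inv p.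
inv-* : ∀ p q → inv (p * q) ≡ inv p * inv q
inv-* p q with 0ℚ ℚ.≟ p | 0ℚ ℚ.≟ q
... | yes refl | _        = trans (cong inv (ℚP.*-zeroˡ q)) (sym (ℚP.*-zeroˡ (inv q)))
... | no _     | yes refl = trans (cong inv (ℚP.*-zeroʳ p)) (sym (ℚP.*-zeroʳ (inv p)))
... | no 0≢p   | no 0≢q   = inv-unique (p * q) (begin
  p * q * (inv p * inv q)   ≡⟨ interchange p q (inv p) (inv q) ⟩
  p * inv p * (q * inv q)   ≡⟨ cong₂ _*_ (inv-inverseʳ (0≢p ∘ sym)) (inv-inverseʳ (0≢q ∘ sym)) ⟩
  1ℚ                        ∎)
  where open ≡-Reasoning

powℤ-suc : ∀ {x} → x ≢ 0ℚ → ∀ i → powℤ x (i ℤ.+ + 1) ≡ x * powℤ x i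
powℤ-suc {x} x≢0 (+ n)          = cong (powℕ x) (ℕP.+-comm n 1)
powℤ-suc {x} x≢0 -[1+ zero ]    = sym (trans (cong (λ y → x * inv y) (ℚP.*-identityʳ x)) (inv-inverseʳ x≢0))
powℤ-suc {x} x≢0 -[1+ suc n ]   = sym (begin
  x * inv (x * xⁿ⁺¹)        ≡⟨ cong (x *_) (inv-* x xⁿ⁺¹) ⟩
  x * (inv x * inv xⁿ⁺¹)    ≡⟨ ℚP.*-assoc x (inv x) (inv xⁿ⁺¹) ⟨
  x * inv x * inv xⁿ⁺¹      ≡⟨ cong (_* inv xⁿ⁺¹) (inv-inverseʳ x≢0) ⟩
  1ℚ * inv xⁿ⁺¹             ≡⟨ ℚP.*-identityˡ (inv xⁿ⁺¹) ⟩
  inv xⁿ⁺¹                  ∎)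
  where
  open ≡-Reasoning
  xⁿ⁺¹ : ℚ
  xⁿ⁺¹ = powℕ x (suc n)

powℤ-pred : ∀ {x} → x ≢ 0ℚ → ∀ i → powℤ x (i ℤ.- + 1) ≡ inv x * powℤ x i
powℤ-pred {x} x≢0 i = begin
  powℤ x (i ℤ.- + 1)                     ≡⟨ ℚP.*-identityˡ _ ⟨
  1ℚ * powℤ x (i ℤ.- + 1)                ≡⟨ cong (_* powℤ x (i ℤ.- + 1)) x⁻¹*x≡1 ⟨
  inv x * x * powℤ x (i ℤ.- + 1)         ≡⟨ ℚP.*-assoc (inv x) x _ ⟩
  inv x * (x * powℤ x (i ℤ.- + 1))       ≡⟨ cong (inv x *_) (powℤ-suc x≢0 (i ℤ.- + 1)) ⟨
  inv x * powℤ x (i ℤ.- + 1 ℤ.+ + 1)     ≡⟨ cong (λ e → inv x * powℤ x e) {i ℤ.- + 1 ℤ.+ + 1} {i} (ℤ-Solver.solve (i ∷ [])) ⟩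
  inv x * powℤ x i                       ∎
  where
  open ≡-Reasoning
  x⁻¹*x≡1 : inv x * x ≡ 1ℚ
  x⁻¹*x≡1 = trans (ℚP.*-comm (inv x) x) (inv-inverseʳ x≢0)

[n+1]*nCk≡[k+1]*[n+1]C[k+1] : ∀ n k → suc n ℕ.* (n C k) ≡ suc k ℕ.* (suc n C suc k)
[n+1]*nCk≡[k+1]*[n+1]C[k+1] zero    zero    = refl
[n+1]*nCk≡[k+1]*[n+1]C[k+1] zero    (suc k) = sym (ℕP.*-zeroʳ (suc (suc k)))
[n+1]*nCk≡[k+1]*[n+1]C[k+1] (suc n) zero    =
  trans (ℕP.*-identityʳ (suc (suc n))) (sym (trans (ℕP.*-identityˡ _) (nC1≡n (suc (suc n)))))
[n+1]*nCk≡[k+1]*[n+1]C[k+1] (suc n) (suc k) = begin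
  suc (suc n) ℕ.* (suc n C suc k)            ≡⟨⟩
  D ℕ.+ suc n ℕ.* (suc n C suc k)            ≡⟨ cong (λ c → D ℕ.+ suc n ℕ.* c) (nCk+nC[k+1]≡[n+1]C[k+1] n k) ⟨
  D ℕ.+ suc n ℕ.* (n C k ℕ.+ n C suc k)      ≡⟨ cong (D ℕ.+_) (ℕP.*-distribˡ-+ (suc n) (n C k) (n C suc k)) ⟩
  D ℕ.+ (suc n ℕ.* (n C k) ℕ.+ suc n ℕ.* (n C suc k))
    ≡⟨ cong (D ℕ.+_) (cong₂ ℕ._+_ ([n+1]*nCk≡[k+1]*[n+1]C[k+1] n k) ([n+1]*nCk≡[k+1]*[n+1]C[k+1] n (suc k))) ⟩
  D ℕ.+ (suc k ℕ.* D ℕ.+ suc (suc k) ℕ.* E)  ≡⟨ regroup k D E ⟩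
  suc (suc k) ℕ.* (D ℕ.+ E)                  ≡⟨ cong (suc (suc k) ℕ.*_) (nCk+nC[k+1]≡[n+1]C[k+1] (suc n) (suc k)) ⟩
  suc (suc k) ℕ.* (suc (suc n) C suc (suc k)) ∎
  where
  open ≡-Reasoning
  D E : ℕ
  D = suc n C suc k
  E = suc n C suc (suc k)
  regroup : ∀ k d e → d ℕ.+ (suc k ℕ.* d ℕ.+ suc (suc k) ℕ.* e) ≡ suc (suc k) ℕ.* (d ℕ.+ e)
  regroup = ℕ-Solver.solve-∀

pos-pascal : ∀ n k → + (suc n C suc k) ≡ + (n C k) ℤ.+ + (n C suc k)
pos-pascal n k = trans (cong +_ (sym (nCk+nC[k+1]≡[n+1]C[k+1] n k))) (ℤP.pos-+ (n C k) (n C suc k))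

pos-2*suc : ∀ n → + (2 ℕ.* suc n) ≡ + 2 ℤ.+ + (2 ℕ.* n)
pos-2*suc n = trans (cong +_ (ℕP.*-distribˡ-+ 2 1 n)) (ℤP.pos-+ 2 (2 ℕ.* n))

pos-sub-2*-+ : ∀ a b m n →
  + a ℤ.- + (2 ℕ.* m) ℤ.+ + b ℤ.- + (2 ℕ.* n) ≡ + (a ℕ.+ b) ℤ.- + (2 ℕ.* (m ℕ.+ n))
pos-sub-2*-+ a b m n = trans (merge (+ a) (+ (2 ℕ.* m)) (+ b) (+ (2 ℕ.* n)))
  (sym (cong₂ ℤ._-_ (ℤP.pos-+ a b) (trans (cong +_ (ℕP.*-distribˡ-+ 2 m n)) (ℤP.pos-+ (2 ℕ.* m) (2 ℕ.* n)))))
  where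
  merge : ∀ a b x y → a ℤ.- b ℤ.+ x ℤ.- y ≡ a ℤ.+ x ℤ.- (b ℤ.+ y)
  merge = ℤ-Solver.solve-∀

bracket-pascal : ∀ M m → bracket (suc M) (suc m) ≡ bracket M (suc m) ℤ.+ bracket M m
bracket-pascal M zero    = trans (cong (ℤ._- + 1) (pos-pascal M 0)) (a+b-a≡b-a+a (+ 1) (+ (M C 1)))
  where
  a+b-a≡b-a+a : ∀ a b → a ℤ.+ b ℤ.- a ≡ b ℤ.- a ℤ.+ a
  a+b-a≡b-a+a = ℤ-Solver.solve-∀
bracket-pascal M (suc m) = trans (cong₂ ℤ._-_ (pos-pascal M (suc m)) (pos-pascal M m))
                              (telescope (+ (M C m)) (+ (M C suc m)) (+ (M C suc (suc m))))
  where
  telescope : ∀ a b c → b ℤ.+ c ℤ.- (a ℤ.+ b) ≡ c ℤ.- b ℤ.+ (b ℤ.- a)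
  telescope = ℤ-Solver.solve-∀

bracket-absorption : ∀ M m → + suc M ℤ.* bracket M m ≡ + (suc M C m) ℤ.* (+ suc M ℤ.- + (2 ℕ.* m))
bracket-absorption M zero    =
  trans (ℤP.*-identityʳ (+ suc M)) (sym (trans (ℤP.*-identityˡ _) (ℤP.+-identityʳ (+ suc M))))
bracket-absorption M (suc t) = begin
  + suc M ℤ.* (+ (M C suc t) ℤ.- + (M C t))
    ≡⟨ absorb (+ suc M) (+ suc t) (+ (M C suc t)) (+ (M C t)) (pos-pascal M t) pos-absorption ⟩
  + (suc M C suc t) ℤ.* (+ suc M ℤ.- (+ suc t ℤ.+ + suc t))
    ≡⟨ cong (λ e → + (suc M C suc t) ℤ.* (+ suc M ℤ.- e)) 2*[t+1] ⟨
  + (suc M C suc t) ℤ.* (+ suc M ℤ.- + (2 ℕ.* suc t))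
    ∎
  where
  open ≡-Reasoning
  pos-absorption : + suc M ℤ.* + (M C t) ≡ + suc t ℤ.* + (suc M C suc t)
  pos-absorption = begin
    + suc M ℤ.* + (M C t)             ≡⟨ ℤP.pos-* (suc M) (M C t) ⟨
    + (suc M ℕ.* (M C t))             ≡⟨ cong +_ ([n+1]*nCk≡[k+1]*[n+1]C[k+1] M t) ⟩
    + (suc t ℕ.* (suc M C suc t))     ≡⟨ ℤP.pos-* (suc t) (suc M C suc t) ⟩
    + suc t ℤ.* + (suc M C suc t)     ∎
  2*[t+1] : + (2 ℕ.* suc t) ≡ + suc t ℤ.+ + suc t
  2*[t+1] = trans (cong (λ n → + (suc t ℕ.+ n)) (ℕP.+-identityʳ (suc t))) (ℤP.pos-+ (suc t) (suc t))
  absorb : ∀ s u a b {d} → d ≡ b ℤ.+ a → s ℤ.* b ≡ u ℤ.* d → s ℤ.* (a ℤ.- b) ≡ d ℤ.* (s ℤ.- (u ℤ.+ u))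
  absorb s u a b refl sb≡ud = begin
    s ℤ.* (a ℤ.- b)                                  ≡⟨ ℤ-Solver.solve (s ∷ a ∷ b ∷ []) ⟩
    s ℤ.* (b ℤ.+ a) ℤ.- (s ℤ.* b ℤ.+ s ℤ.* b)        ≡⟨ cong (λ v → s ℤ.* (b ℤ.+ a) ℤ.- (v ℤ.+ v)) sb≡ud ⟩
    s ℤ.* (b ℤ.+ a) ℤ.- (u ℤ.* (b ℤ.+ a) ℤ.+ u ℤ.* (b ℤ.+ a))
                                                     ≡⟨ ℤ-Solver.solve (s ∷ u ∷ a ∷ b ∷ []) ⟩
    (b ℤ.+ a) ℤ.* (s ℤ.- (u ℤ.+ u))                  ∎

∑ : ℕ → (ℕ → ℚ) → ℚ
∑ zero    f = 0ℚ
∑ (suc n) f = f 0 + ∑ n (f ∘ suc)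

∑-cong : ∀ n {f g : ℕ → ℚ} → (∀ i → f i ≡ g i) → ∑ n f ≡ ∑ n g
∑-cong zero    f≗g = refl
∑-cong (suc n) f≗g = cong₂ _+_ (f≗g 0) (∑-cong n (f≗g ∘ suc))

∑-+ : ∀ n (f g : ℕ → ℚ) → ∑ n (λ i → f i + g i) ≡ ∑ n f + ∑ n g
∑-+ zero    f g = refl
∑-+ (suc n) f g = trans (cong (_+_ (f 0 + g 0)) (∑-+ n (f ∘ suc) (g ∘ suc)))
                        (interchange⁺ (f 0) (g 0) (∑ n (f ∘ suc)) (∑ n (g ∘ suc)))

*-distribˡ-∑ : ∀ n c (f : ℕ → ℚ) → c * ∑ n f ≡ ∑ n (λ i → c * f i)
*-distribˡ-∑ zero    c f = ℚP.*-zeroʳ c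
*-distribˡ-∑ (suc n) c f = trans (ℚP.*-distribˡ-+ c (f 0) _) (cong (_+_ (c * f 0)) (*-distribˡ-∑ n c (f ∘ suc)))

∑-dropLast : ∀ n (f : ℕ → ℚ) → f n ≡ 0ℚ → ∑ (suc n) f ≡ ∑ n f
∑-dropLast zero    f f0≡0 = trans (ℚP.+-identityʳ (f 0)) f0≡0
∑-dropLast (suc n) f fn≡0 = cong (_+_ (f 0)) (∑-dropLast n (f ∘ suc) fn≡0)

sumℚ-cons : ∀ {a b} f → a ≤ b → sumℚ a b f ≡ f a + sumℚ (suc a) b f
sumℚ-cons {a} {b} f a≤b rewrite ℕP.+-∸-assoc 1 a≤b = refl

sumℚ-empty : ∀ {a b} f → b < a → sumℚ a b f ≡ 0ℚ
sumℚ-empty f b<a rewrite ℕP.m≤n⇒m∸n≡0 b<a = refl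

sumℚ≡∑ : ∀ a n f → sumℚ a (a ℕ.+ n) f ≡ ∑ (suc n) (λ i → f (a ℕ.+ i))
sumℚ≡∑ a zero    f rewrite ℕP.+-identityʳ a =
  trans (sumℚ-cons f ℕP.≤-refl) (cong (_+_ (f a)) (sumℚ-empty f (ℕP.n<1+n a)))
sumℚ≡∑ a (suc n) f = begin
  sumℚ a (a ℕ.+ suc n) f
    ≡⟨ sumℚ-cons f (ℕP.m≤m+n a (suc n)) ⟩
  f a + sumℚ (suc a) (a ℕ.+ suc n) f
    ≡⟨ cong₂ _+_ (cong f (sym (ℕP.+-identityʳ a))) (cong (λ b → sumℚ (suc a) b f) (ℕP.+-suc a n)) ⟩
  f (a ℕ.+ 0) + sumℚ (suc a) (suc a ℕ.+ n) f
    ≡⟨ cong (_+_ (f (a ℕ.+ 0))) (sumℚ≡∑ (suc a) n f) ⟩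
  f (a ℕ.+ 0) + ∑ (suc n) (λ i → f (suc a ℕ.+ i))
    ≡⟨ cong (_+_ (f (a ℕ.+ 0))) (∑-cong (suc n) (λ i → cong f (ℕP.+-suc a i))) ⟨
  ∑ (suc (suc n)) (λ i → f (a ℕ.+ i))
    ∎
  where open ≡-Reasoning

sumℤ-cons : ∀ {a b} f → a ≤ b → sumℤ a b f ≡ f a ℤ.+ sumℤ (suc a) b f
sumℤ-cons {a} {b} f a≤b rewrite ℕP.+-∸-assoc 1 a≤b = refl

sumℤ-empty : ∀ {a b} f → b < a → sumℤ a b f ≡ + 0
sumℤ-empty f b<a rewrite ℕP.m≤n⇒m∸n≡0 b<a = refl

ofℤ-sumℤ≡∑ : ∀ a n f → ofℤ (sumℤ a (a ℕ.+ n) f) ≡ ∑ (suc n) (λ i → ofℤ (f (a ℕ.+ i)))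
ofℤ-sumℤ≡∑ a zero    f rewrite ℕP.+-identityʳ a =
  trans (cong ofℤ (sumℤ-cons f ℕP.≤-refl))
        (trans (ofℤ-+ (f a) _) (cong (λ y → ofℤ (f a) + ofℤ y) (sumℤ-empty f (ℕP.n<1+n a))))
ofℤ-sumℤ≡∑ a (suc n) f = begin
  ofℤ (sumℤ a (a ℕ.+ suc n) f)
    ≡⟨ cong ofℤ (sumℤ-cons f (ℕP.m≤m+n a (suc n))) ⟩
  ofℤ (f a ℤ.+ sumℤ (suc a) (a ℕ.+ suc n) f)
    ≡⟨ ofℤ-+ (f a) _ ⟩
  ofℤ (f a) + ofℤ (sumℤ (suc a) (a ℕ.+ suc n) f)
    ≡⟨ cong₂ _+_ (cong (ofℤ ∘ f) (sym (ℕP.+-identityʳ a))) (cong (λ b → ofℤ (sumℤ (suc a) b f)) (ℕP.+-suc a n)) ⟩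
  ofℤ (f (a ℕ.+ 0)) + ofℤ (sumℤ (suc a) (suc a ℕ.+ n) f)
    ≡⟨ cong (_+_ (ofℤ (f (a ℕ.+ 0)))) (ofℤ-sumℤ≡∑ (suc a) n f) ⟩
  ofℤ (f (a ℕ.+ 0)) + ∑ (suc n) (λ i → ofℤ (f (suc a ℕ.+ i)))
    ≡⟨ cong (_+_ (ofℤ (f (a ℕ.+ 0)))) (∑-cong (suc n) (λ i → cong (ofℤ ∘ f) (ℕP.+-suc a i))) ⟨
  ∑ (suc (suc n)) (λ i → ofℤ (f (a ℕ.+ i)))
    ∎
  where open ≡-Reasoning

shift : (ℕ → ℚ) → ℕ → ℚ
shift a zero    = 0ℚ
shift a (suc n) = a n

∑-+-shift : ∀ N (a b c : ℕ → ℚ) → (∀ m → c m ≡ a m + shift b m) → a N ≡ 0ℚ →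
            ∑ (suc N) c ≡ ∑ N a + ∑ N b
∑-+-shift N a b c c≗a+Xb aN≡0 = begin
  ∑ (suc N) c                              ≡⟨ ∑-cong (suc N) c≗a+Xb ⟩
  ∑ (suc N) (λ m → a m + shift b m)        ≡⟨ ∑-+ (suc N) a (shift b) ⟩
  ∑ (suc N) a + (0ℚ + ∑ N b)               ≡⟨ cong₂ _+_ (∑-dropLast N a aN≡0) (ℚP.+-identityˡ (∑ N b)) ⟩
  ∑ N a + ∑ N b                            ∎
  where open ≡-Reasoning

∑-+-shift-* : ∀ N (a b c F : ℕ → ℚ) → (∀ m → c m ≡ a m + shift b m) → a N ≡ 0ℚ →
              ∑ (suc N) (λ m → c m * F m) ≡ ∑ N (λ m → a m * F m) + ∑ N (λ m → b m * F (suc m))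
∑-+-shift-* N a b c F c≗a+Xb aN≡0 =
  ∑-+-shift N (λ m → a m * F m) (λ m → b m * F (suc m)) (λ m → c m * F m) distrib
    (trans (cong (_* F N) aN≡0) (ℚP.*-zeroˡ (F N)))
  where
  open ≡-Reasoning
  shift-* : ∀ m → shift b m * F m ≡ shift (λ m → b m * F (suc m)) m
  shift-* zero    = ℚP.*-zeroˡ (F 0)
  shift-* (suc m) = refl
  distrib : ∀ m → c m * F m ≡ a m * F m + shift (λ m → b m * F (suc m)) m
  distrib m = begin
    c m * F m                                    ≡⟨ cong (_* F m) (c≗a+Xb m) ⟩
    (a m + shift b m) * F m                      ≡⟨ ℚP.*-distribʳ-+ (F m) (a m) (shift b m) ⟩
    a m * F m + shift b m * F m                  ≡⟨ cong (_+_ (a m * F m)) (shift-* m) ⟩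
    a m * F m + shift (λ m → b m * F (suc m)) m  ∎

binomialℚ : ℕ → ℕ → ℚ
binomialℚ n m = ofℕ (n C m)

bracketℚ : ℕ → ℕ → ℚ
bracketℚ M m = ofℤ (bracket M m)

binomialℚ-pascal : ∀ n m → binomialℚ (suc n) m ≡ binomialℚ n m + shift (binomialℚ n) m
binomialℚ-pascal n zero    = sym (ℚP.+-identityʳ 1ℚ)
binomialℚ-pascal n (suc m) =
  trans (cong ofℕ (trans (sym (nCk+nC[k+1]≡[n+1]C[k+1] n m)) (ℕP.+-comm (n C m) (n C suc m))))
        (ofℕ-+ (n C suc m) (n C m))

binomialℚ-vanish : ∀ n → binomialℚ n (suc n) ≡ 0ℚ
binomialℚ-vanish n = cong ofℕ (k>n⇒nCk≡0 (ℕP.n<1+n n))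

bracketℚ-pascal : ∀ M m → bracketℚ (suc M) m ≡ bracketℚ M m + shift (bracketℚ M) m
bracketℚ-pascal M zero    = sym (ℚP.+-identityʳ 1ℚ)
bracketℚ-pascal M (suc m) = trans (cong ofℤ (bracket-pascal M m)) (ofℤ-+ (bracket M (suc m)) (bracket M m))

bracketℚ-vanish : ∀ M {m} → suc (suc M) ≤ m → bracketℚ M m ≡ 0ℚ
bracketℚ-vanish M {suc m} (s≤s M<m) =
  cong ofℤ (cong₂ (λ a b → + a ℤ.- + b) (k>n⇒nCk≡0 (ℕP.m<n⇒m<1+n M<m)) (k>n⇒nCk≡0 M<m))

bracketℚ≡binomialℚ-shift : ∀ M m → bracketℚ M m ≡ binomialℚ M m + shift (λ n → - binomialℚ M n) m
bracketℚ≡binomialℚ-shift M zero    = sym (ℚP.+-identityʳ 1ℚ)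
bracketℚ≡binomialℚ-shift M (suc m) = ofℤ-- (+ (M C suc m)) (+ (M C m))

∑-binomialℚ : ∀ n → ∑ (suc n) (binomialℚ n) ≡ ofℕ (2 ℕ.^ n)
∑-binomialℚ zero    = refl
∑-binomialℚ (suc n) = begin
  ∑ (suc (suc n)) (binomialℚ (suc n))
    ≡⟨ ∑-+-shift (suc n) (binomialℚ n) (binomialℚ n) _ (binomialℚ-pascal n) (binomialℚ-vanish n) ⟩
  ∑ (suc n) (binomialℚ n) + ∑ (suc n) (binomialℚ n)
    ≡⟨ cong₂ _+_ (∑-binomialℚ n) (∑-binomialℚ n) ⟩
  ofℕ (2 ℕ.^ n) + ofℕ (2 ℕ.^ n)
    ≡⟨ ofℕ-+ (2 ℕ.^ n) (2 ℕ.^ n) ⟨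
  ofℕ (2 ℕ.^ n ℕ.+ 2 ℕ.^ n)
    ≡⟨ cong (λ k → ofℕ (2 ℕ.^ n ℕ.+ k)) (ℕP.+-identityʳ (2 ℕ.^ n)) ⟨
  ofℕ (2 ℕ.^ suc n)
    ∎
  where open ≡-Reasoning

powℕ-x+x⁻¹-expansion : ∀ {x} → x ≢ 0ℚ → ∀ J →
  powℕ (x + inv x) J * (x - inv x) ≡ ∑ (suc (suc J)) (λ m → bracketℚ J m * powℤ x (+ suc J ℤ.- + (2 ℕ.* m)))
powℕ-x+x⁻¹-expansion {x} x≢0 zero    = begin
  1ℚ * (x - inv x)                               ≡⟨ expand x (inv x) ⟩
  1ℚ * x + (- 1ℚ * inv x + 0ℚ)                   ≡⟨ cong (λ y → 1ℚ * y + (- 1ℚ * inv y + 0ℚ)) (ℚP.*-identityʳ x) ⟨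
  1ℚ * (x * 1ℚ) + (- 1ℚ * inv (x * 1ℚ) + 0ℚ)     ∎
  where
  open ≡-Reasoning
  expand : ∀ x y → 1ℚ * (x - y) ≡ 1ℚ * x + (- 1ℚ * y + 0ℚ)
  expand = solve-∀ ℚ-ring
powℕ-x+x⁻¹-expansion {x} x≢0 (suc J) = sym (begin
  ∑ (suc (suc (suc J))) (λ m → bracketℚ (suc J) m * F m)
    ≡⟨ ∑-+-shift-* (suc (suc J)) (bracketℚ J) (bracketℚ J) (bracketℚ (suc J)) F
                   (bracketℚ-pascal J) (bracketℚ-vanish J ℕP.≤-refl) ⟩
  ∑ (suc (suc J)) (λ m → bracketℚ J m * F m) + ∑ (suc (suc J)) (λ m → bracketℚ J m * F (suc m))
    ≡⟨ cong₂ _+_ (∑-factor x F F≡x*G) (∑-factor (inv x) (F ∘ suc) F∘suc≡x⁻¹*G) ⟩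
  x * S + inv x * S
    ≡⟨ ℚP.*-distribʳ-+ S x (inv x) ⟨
  (x + inv x) * S
    ≡⟨ cong (_*_ (x + inv x)) (powℕ-x+x⁻¹-expansion x≢0 J) ⟨
  (x + inv x) * (powℕ (x + inv x) J * (x - inv x))
    ≡⟨ ℚP.*-assoc (x + inv x) _ _ ⟨
  powℕ (x + inv x) (suc J) * (x - inv x)
    ∎)
  where
  open ≡-Reasoning
  F G : ℕ → ℚ
  F m = powℤ x (+ suc (suc J) ℤ.- + (2 ℕ.* m))
  G m = powℤ x (+ suc J ℤ.- + (2 ℕ.* m))
  S : ℚ
  S = ∑ (suc (suc J)) (λ m → bracketℚ J m * G m)
  ∑-factor : ∀ c (H : ℕ → ℚ) → (∀ m → H m ≡ c * G m) → ∑ (suc (suc J)) (λ m → bracketℚ J m * H m) ≡ c * S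
  ∑-factor c H H≗cG =
    trans (∑-cong (suc (suc J)) (λ m → trans (cong (_*_ (bracketℚ J m)) (H≗cG m)) (x∙yz≈y∙xz (bracketℚ J m) c (G m))))
          (sym (*-distribˡ-∑ (suc (suc J)) c (λ m → bracketℚ J m * G m)))
  1+a-e≡a-e+1 : ∀ a e → + 1 ℤ.+ a ℤ.- e ≡ a ℤ.- e ℤ.+ + 1
  1+a-e≡a-e+1 = ℤ-Solver.solve-∀
  1+a-[2+e]≡a-e-1 : ∀ a e → + 1 ℤ.+ a ℤ.- (+ 2 ℤ.+ e) ≡ a ℤ.- e ℤ.- + 1
  1+a-[2+e]≡a-e-1 = ℤ-Solver.solve-∀
  F≡x*G : ∀ m → F m ≡ x * G m
  F≡x*G m = trans (cong (powℤ x) (1+a-e≡a-e+1 (+ suc J) (+ (2 ℕ.* m)))) (powℤ-suc x≢0 (+ suc J ℤ.- + (2 ℕ.* m)))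
  F∘suc≡x⁻¹*G : ∀ m → F (suc m) ≡ inv x * G m
  F∘suc≡x⁻¹*G m = trans (cong (powℤ x) (trans (cong (λ e → + suc (suc J) ℤ.- e) (pos-2*suc m))
                                              (1+a-[2+e]≡a-e-1 (+ suc J) (+ (2 ℕ.* m)))))
                        (powℤ-pred x≢0 (+ suc J ℤ.- + (2 ℕ.* m)))

∑-bracketℚ-weighted : ∀ K → ∑ (suc (suc K)) (λ n → bracketℚ K n * ofℤ (+ suc K ℤ.- + (2 ℕ.* n))) ≡ ofℕ (2 ℕ.^ suc K)
∑-bracketℚ-weighted K = begin
  ∑ (suc (suc K)) (λ n → bracketℚ K n * W n)
    ≡⟨ ∑-+-shift-* (suc K) (binomialℚ K) (λ n → - binomialℚ K n) (bracketℚ K) W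
                   (bracketℚ≡binomialℚ-shift K) (binomialℚ-vanish K) ⟩
  ∑ (suc K) (λ n → binomialℚ K n * W n) + ∑ (suc K) (λ n → - binomialℚ K n * W (suc n))
    ≡⟨ ∑-+ (suc K) (λ n → binomialℚ K n * W n) (λ n → - binomialℚ K n * W (suc n)) ⟨
  ∑ (suc K) (λ n → binomialℚ K n * W n + - binomialℚ K n * W (suc n))
    ≡⟨ ∑-cong (suc K) (λ n → trans (factor (binomialℚ K n) (W n) (W (suc n))) (cong (_* binomialℚ K n) (W-step n))) ⟩
  ∑ (suc K) (λ n → ofℕ 2 * binomialℚ K n)
    ≡⟨ *-distribˡ-∑ (suc K) (ofℕ 2) (binomialℚ K) ⟨
  ofℕ 2 * ∑ (suc K) (binomialℚ K)
    ≡⟨ cong (_*_ (ofℕ 2)) (∑-binomialℚ K) ⟩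
  ofℕ 2 * ofℕ (2 ℕ.^ K)
    ≡⟨ ofℕ-* 2 (2 ℕ.^ K) ⟨
  ofℕ (2 ℕ.^ suc K)
    ∎
  where
  open ≡-Reasoning
  W : ℕ → ℚ
  W n = ofℤ (+ suc K ℤ.- + (2 ℕ.* n))
  a-e-[a-[2+e]]≡2 : ∀ a e → a ℤ.- e ℤ.- (a ℤ.- (+ 2 ℤ.+ e)) ≡ + 2
  a-e-[a-[2+e]]≡2 = ℤ-Solver.solve-∀
  W-step : ∀ n → W n - W (suc n) ≡ ofℕ 2
  W-step n = trans (sym (ofℤ-- (+ suc K ℤ.- + (2 ℕ.* n)) (+ suc K ℤ.- + (2 ℕ.* suc n))))
                   (cong ofℤ (trans (cong (λ e → + suc K ℤ.- + (2 ℕ.* n) ℤ.- (+ suc K ℤ.- e)) (pos-2*suc n))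
                                    (a-e-[a-[2+e]]≡2 (+ suc K) (+ (2 ℕ.* n)))))
  factor : ∀ a u v → a * u + - a * v ≡ (u - v) * a
  factor = solve-∀ ℚ-ring

sumℤ-bracket-weighted : ∀ K →
  + (2 ℕ.^ suc K) ≡ sumℤ 0 (suc K) (λ n → bracket K n ℤ.* (+ suc K ℤ.- + (2 ℕ.* n)))
sumℤ-bracket-weighted K = ofℤ-injective (sym (begin
  ofℤ (sumℤ 0 (suc K) (λ n → bracket K n ℤ.* w n))      ≡⟨ ofℤ-sumℤ≡∑ 0 (suc K) (λ n → bracket K n ℤ.* w n) ⟩
  ∑ (suc (suc K)) (λ n → ofℤ (bracket K n ℤ.* w n))     ≡⟨ ∑-cong (suc (suc K)) (λ n → ofℤ-* (bracket K n) (w n)) ⟩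
  ∑ (suc (suc K)) (λ n → bracketℚ K n * ofℤ (w n))      ≡⟨ ∑-bracketℚ-weighted K ⟩
  ofℕ (2 ℕ.^ suc K)                                     ∎))
  where
  open ≡-Reasoning
  w : ℕ → ℤ
  w n = + suc K ℤ.- + (2 ℕ.* n)

a*b≡c*d⇒b*d⁻¹≡a⁻¹*c : ∀ {a b c d} → a ≢ 0ℚ → d ≢ 0ℚ → a * b ≡ c * d → b * inv d ≡ inv a * c
a*b≡c*d⇒b*d⁻¹≡a⁻¹*c {a} {b} {c} {d} a≢0 d≢0 ab≡cd = begin
  b * inv d                      ≡⟨ ℚP.*-identityˡ (b * inv d) ⟨
  1ℚ * (b * inv d)               ≡⟨ cong (_* (b * inv d)) (inv-inverseʳ a≢0) ⟨
  a * inv a * (b * inv d)        ≡⟨ regroupˡ a (inv a) b (inv d) ⟩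
  inv a * (a * b) * inv d        ≡⟨ cong (λ y → inv a * y * inv d) ab≡cd ⟩
  inv a * (c * d) * inv d        ≡⟨ regroupʳ (inv a) c d (inv d) ⟩
  inv a * c * (d * inv d)        ≡⟨ cong (_*_ (inv a * c)) (inv-inverseʳ d≢0) ⟩
  inv a * c * 1ℚ                 ≡⟨ ℚP.*-identityʳ (inv a * c) ⟩
  inv a * c                      ∎
  where
  open ≡-Reasoning
  regroupˡ : ∀ x y z w → x * y * (z * w) ≡ y * (x * z) * w
  regroupˡ = solve-∀ ℚ-ring
  regroupʳ : ∀ x y z w → x * (y * z) * w ≡ x * y * (z * w)
  regroupʳ = solve-∀ ℚ-ring

odd-2m≢0 : ∀ {N} m → Odd N → ofℤ (+ N ℤ.- + (2 ℕ.* m)) ≢ 0ℚ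
odd-2m≢0 m (t , refl) eq = ℕP.even≢odd m t (sym (ℤP.+-injective (ℤP.i-j≡0⇒i≡j _ _ (ofℤ-injective eq))))

odd+even : ∀ {m n} → Odd m → Even n → Odd (m ℕ.+ n)
odd+even (t , refl) (s , refl) = t ℕ.+ s , cong suc (sym (ℕP.*-distribˡ-+ 2 t s))

bracketℚ-over-weight : ∀ M m → Odd (suc M) →
  bracketℚ M m * inv (ofℤ (+ suc M ℤ.- + (2 ℕ.* m))) ≡ inv (ofℕ (suc M)) * binomialℚ (suc M) m
bracketℚ-over-weight M m odd = a*b≡c*d⇒b*d⁻¹≡a⁻¹*c (ofℕ-suc≢0 M) (odd-2m≢0 m odd) (begin
  ofℕ (suc M) * bracketℚ M m                                  ≡⟨ ofℤ-* (+ suc M) (bracket M m) ⟨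
  ofℤ (+ suc M ℤ.* bracket M m)                               ≡⟨ cong ofℤ (bracket-absorption M m) ⟩
  ofℤ (+ (suc M C m) ℤ.* (+ suc M ℤ.- + (2 ℕ.* m)))           ≡⟨ ofℤ-* (+ (suc M C m)) _ ⟩
  binomialℚ (suc M) m * ofℤ (+ suc M ℤ.- + (2 ℕ.* m))         ∎)
  where open ≡-Reasoning

-- Stated for N ≡ suc M so that it applies to N = j + k, which is a successor only propositionally.
∑-bracketℚ-over-weight : ∀ {N M} → N ≡ suc M → Odd N →
  ∑ (suc N) (λ m → bracketℚ M m * inv (ofℤ (+ N ℤ.- + (2 ℕ.* m)))) ≡ ofℕ (2 ℕ.^ N) * inv (ofℕ N)
∑-bracketℚ-over-weight {M = M} refl odd = begin
  ∑ (suc (suc M)) (λ m → bracketℚ M m * inv (ofℤ (+ suc M ℤ.- + (2 ℕ.* m))))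
    ≡⟨ ∑-cong (suc (suc M)) (λ m → bracketℚ-over-weight M m odd) ⟩
  ∑ (suc (suc M)) (λ m → inv (ofℕ (suc M)) * binomialℚ (suc M) m)
    ≡⟨ *-distribˡ-∑ (suc (suc M)) (inv (ofℕ (suc M))) (binomialℚ (suc M)) ⟨
  inv (ofℕ (suc M)) * ∑ (suc (suc M)) (binomialℚ (suc M))
    ≡⟨ cong (_*_ (inv (ofℕ (suc M)))) (∑-binomialℚ (suc M)) ⟩
  inv (ofℕ (suc M)) * ofℕ (2 ℕ.^ suc M)
    ≡⟨ ℚP.*-comm (inv (ofℕ (suc M))) (ofℕ (2 ℕ.^ suc M)) ⟩
  ofℕ (2 ℕ.^ suc M) * inv (ofℕ (suc M))
    ∎
  where open ≡-Reasoning

-- Generalising over h lets the shifted half C(j, m − 1) of Pascal's rule be absorbed into h ∘ suc.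
∑-binomialℚ-convolution : ∀ (B : ℕ → ℕ → ℚ) L →
  (∀ j m → B (suc j) m ≡ B j m + shift (B j) m) → (∀ j → B j (j ℕ.+ L) ≡ 0ℚ) →
  ∀ j (h : ℕ → ℚ) →
  ∑ (suc j) (λ m → binomialℚ j m * ∑ L (λ n → B 0 n * h (m ℕ.+ n))) ≡ ∑ (j ℕ.+ L) (λ p → B j p * h p)
∑-binomialℚ-convolution B L B-pascal B-vanish zero    h =
  trans (ℚP.+-identityʳ (1ℚ * ∑ L (λ n → B 0 n * h n))) (ℚP.*-identityˡ (∑ L (λ n → B 0 n * h n)))
∑-binomialℚ-convolution B L B-pascal B-vanish (suc j) h = begin
  ∑ (suc (suc j)) (λ m → binomialℚ (suc j) m * G h m)
    ≡⟨ ∑-+-shift-* (suc j) (binomialℚ j) (binomialℚ j) (binomialℚ (suc j)) (G h)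
                   (binomialℚ-pascal j) (binomialℚ-vanish j) ⟩
  ∑ (suc j) (λ m → binomialℚ j m * G h m) + ∑ (suc j) (λ m → binomialℚ j m * G (h ∘ suc) m)
    ≡⟨ cong₂ _+_ (∑-binomialℚ-convolution B L B-pascal B-vanish j h)
                 (∑-binomialℚ-convolution B L B-pascal B-vanish j (h ∘ suc)) ⟩
  ∑ (j ℕ.+ L) (λ p → B j p * h p) + ∑ (j ℕ.+ L) (λ p → B j p * h (suc p))
    ≡⟨ ∑-+-shift-* (j ℕ.+ L) (B j) (B j) (B (suc j)) h (B-pascal j) (B-vanish j) ⟨
  ∑ (suc j ℕ.+ L) (λ p → B (suc j) p * h p)
    ∎
  where
  open ≡-Reasoning
  G : (ℕ → ℚ) → ℕ → ℚ
  G h m = ∑ L (λ n → B 0 n * h (m ℕ.+ n))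

∑∑-bracketℚ-over-weights : ∀ J K → Odd (suc J) → Even (suc K) →
  ∑ (suc (suc J)) (λ m → ∑ (suc (suc K)) (λ n →
      bracketℚ J m * bracketℚ K n
        * inv (ofℤ (+ suc J ℤ.- + (2 ℕ.* m)))
        * inv (ofℤ (+ suc J ℤ.- + (2 ℕ.* m) ℤ.+ + suc K ℤ.- + (2 ℕ.* n)))))
    ≡ ofℕ (2 ℕ.^ (suc J ℕ.+ suc K)) * inv (ofℕ (suc J ℕ.* (suc J ℕ.+ suc K)))
∑∑-bracketℚ-over-weights J K j-odd k-even = begin
  ∑ (suc j) (λ m → ∑ (suc k) (T m))
    ≡⟨ ∑-cong (suc j) (λ m → trans (∑-cong (suc k) (T≡ m))
                                   (sym (*-distribˡ-∑ (suc k) (c m) (λ n → bracketℚ K n * h (m ℕ.+ n))))) ⟩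
  ∑ (suc j) (λ m → c m * G m)
    ≡⟨ ∑-cong (suc j) (λ m → ℚP.*-assoc (inv (ofℕ j)) (binomialℚ j m) (G m)) ⟩
  ∑ (suc j) (λ m → inv (ofℕ j) * (binomialℚ j m * G m))
    ≡⟨ *-distribˡ-∑ (suc j) (inv (ofℕ j)) (λ m → binomialℚ j m * G m) ⟨
  inv (ofℕ j) * ∑ (suc j) (λ m → binomialℚ j m * G m)
    ≡⟨ cong (_*_ (inv (ofℕ j))) convolution ⟩
  inv (ofℕ j) * ∑ (suc (j ℕ.+ k)) (λ p → bracketℚ (j ℕ.+ K) p * h p)
    ≡⟨ cong (_*_ (inv (ofℕ j))) (∑-bracketℚ-over-weight (ℕP.+-suc j K) (odd+even j-odd k-even)) ⟩
  inv (ofℕ j) * (ofℕ (2 ℕ.^ (j ℕ.+ k)) * inv (ofℕ (j ℕ.+ k)))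
    ≡⟨ x∙yz≈y∙xz (inv (ofℕ j)) (ofℕ (2 ℕ.^ (j ℕ.+ k))) (inv (ofℕ (j ℕ.+ k))) ⟩
  ofℕ (2 ℕ.^ (j ℕ.+ k)) * (inv (ofℕ j) * inv (ofℕ (j ℕ.+ k)))
    ≡⟨ cong (_*_ (ofℕ (2 ℕ.^ (j ℕ.+ k)))) (trans (cong inv (ofℕ-* j (j ℕ.+ k))) (inv-* (ofℕ j) (ofℕ (j ℕ.+ k)))) ⟨
  ofℕ (2 ℕ.^ (j ℕ.+ k)) * inv (ofℕ (j ℕ.* (j ℕ.+ k)))
    ∎
  where
  open ≡-Reasoning
  j k : ℕ
  j = suc J
  k = suc K
  h : ℕ → ℚ
  h p = inv (ofℤ (+ (j ℕ.+ k) ℤ.- + (2 ℕ.* p)))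
  c G : ℕ → ℚ
  c m = inv (ofℕ j) * binomialℚ j m
  G m = ∑ (suc k) (λ n → bracketℚ K n * h (m ℕ.+ n))
  T : ℕ → ℕ → ℚ
  T m n = bracketℚ J m * bracketℚ K n
            * inv (ofℤ (+ j ℤ.- + (2 ℕ.* m)))
            * inv (ofℤ (+ j ℤ.- + (2 ℕ.* m) ℤ.+ + k ℤ.- + (2 ℕ.* n)))
  regroup : ∀ a b x y → a * b * x * y ≡ a * x * (b * y)
  regroup = solve-∀ ℚ-ring
  T≡ : ∀ m n → T m n ≡ c m * (bracketℚ K n * h (m ℕ.+ n))
  T≡ m n = trans (regroup (bracketℚ J m) (bracketℚ K n) _ _)
                 (cong₂ _*_ (bracketℚ-over-weight J m j-odd)
                            (cong (λ e → bracketℚ K n * inv (ofℤ e)) (pos-sub-2*-+ j k m n)))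
  vanish : ∀ i → bracketℚ (i ℕ.+ K) (i ℕ.+ suc k) ≡ 0ℚ
  vanish i = bracketℚ-vanish (i ℕ.+ K) (ℕP.≤-reflexive (sym (trans (ℕP.+-suc i k) (cong suc (ℕP.+-suc i K)))))
  convolution : ∑ (suc j) (λ m → binomialℚ j m * G m) ≡ ∑ (suc (j ℕ.+ k)) (λ p → bracketℚ (j ℕ.+ K) p * h p)
  convolution = trans
    (∑-binomialℚ-convolution (λ i → bracketℚ (i ℕ.+ K)) (suc k) (λ i → bracketℚ-pascal (i ℕ.+ K)) vanish j h)
    (cong (λ L → ∑ L (λ p → bracketℚ (j ℕ.+ K) p * h p)) (ℕP.+-suc j k))

lemma3 : (j k : ℕ) → 1 ≤ j → 1 ≤ k →
    ((x : ℚ) → x ≢ 0ℚ →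
      powℕ (x ℚ.+ inv x) (j ∸ 1) ℚ.* (x ℚ.- inv x)
        ≡ sumℚ 0 j (λ m → ofℤ (bracket (j ∸ 1) m) ℚ.* powℤ x (+ j ℤ.- + (2 ℕ.* m))))
    × (+ (2 ℕ.^ k) ≡ sumℤ 0 k (λ n → bracket (k ∸ 1) n ℤ.* (+ k ℤ.- + (2 ℕ.* n))))
    × (Odd j →
      ofℕ (2 ℕ.^ j) ℚ.* inv (ofℕ j)
        ≡ sumℚ 0 j (λ m → ofℤ (bracket (j ∸ 1) m) ℚ.* inv (ofℤ (+ j ℤ.- + (2 ℕ.* m)))))
    × (Odd j → Even k →
      ofℕ (2 ℕ.^ (j ℕ.+ k)) ℚ.* inv (ofℕ (j ℕ.* (j ℕ.+ k)))
        ≡ sumℚ 0 j (λ m → sumℚ 0 k (λ n →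
            ofℤ (bracket (j ∸ 1) m) ℚ.* ofℤ (bracket (k ∸ 1) n)
              ℚ.* inv (ofℤ (+ j ℤ.- + (2 ℕ.* m)))
              ℚ.* inv (ofℤ (+ j ℤ.- + (2 ℕ.* m) ℤ.+ + k ℤ.- + (2 ℕ.* n))))))
lemma3 zero    _       () _
lemma3 (suc J) zero    _  ()
lemma3 (suc J) (suc K) _  _ =
    (λ x x≢0 → trans (powℕ-x+x⁻¹-expansion x≢0 J)
                     (sym (sumℚ≡∑ 0 (suc J) (λ m → bracketℚ J m * powℤ x (+ suc J ℤ.- + (2 ℕ.* m))))))
  , sumℤ-bracket-weighted K
  , (λ j-odd → sym (trans (sumℚ≡∑ 0 (suc J) (λ m → bracketℚ J m * inv (ofℤ (+ suc J ℤ.- + (2 ℕ.* m)))))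
                          (∑-bracketℚ-over-weight refl j-odd)))
  , (λ j-odd k-even → sym (trans (sumℚ≡∑ 0 (suc J) (λ m → sumℚ 0 (suc K) (T m)))
                                 (trans (∑-cong (suc (suc J)) (λ m → sumℚ≡∑ 0 (suc K) (T m)))
                                        (∑∑-bracketℚ-over-weights J K j-odd k-even))))
  where
  T : ℕ → ℕ → ℚ
  T m n = bracketℚ J m * bracketℚ K n
            * inv (ofℤ (+ suc J ℤ.- + (2 ℕ.* m)))
            * inv (ofℤ (+ suc J ℤ.- + (2 ℕ.* m) ℤ.+ + suc K ℤ.- + (2 ℕ.* n)))
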